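{- Let $G$ be a graph and let $\ell$ be a weakly subadditive nonnegative integer-valued function on subsets of $V(G)$ with $\ell(\emptyset)=\ell(V(G))=0$. Then $G$ is minimally $\ell$-rigid if and only if $G$ has an $\ell$-arc-connected orientation such that $d^-_G(v)=\ell(v)$ for each vertex $v$.
   Context: Graphs are finite, loopless, multiple edges allowed. $e_G(X)$ is the number of edges with both ends in $X$; $\ell(v)=\ell(\{v\})$; weakly subadditive means $\sum_{v\in A}\ell(v)\ge\ell(A)$ for all $A$. $G$ is minimally $\ell$-rigid if $e_G(X)\le\sum_{v\in X}\ell(v)-\ell(X)$ for all $X\subseteq V(G)$ and $|E(G)|=\sum_{v\in V(G)}\ell(v)-\ell(V(G))$ (equivalently, $G$ is $\ell$-rigid but no proper spanning subgraph is). In an orientation, $d^-(v)$ is the number of arcs entering $v$ and $d^-(A)$ is the number of arcs entering $A$ (tail outside $A$, head in $A$); the orientation is $\ell$-arc-connected if $d^-(A)\ge\ell(A)$ for every vertex set $A$. -}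

module Defs where

open import Data.Nat using (ℕ; zero; suc; _+_; _∸_; _≤_)
open import Data.Bool using (Bool; true; false; if_then_else_; _∧_; not)
open import Data.Fin using (Fin; zero; suc)
open import Data.Fin.Subset using (Subset; _∈_; ⁅_⁆; ⊥; ⊤)
open import Data.Fin.Subset.Properties using (_∈?_)
open import Data.Product using (_×_; _,_; proj₁; proj₂)
open import Relation.Binary.PropositionalEquality using (_≡_; _≢_)
open import Relation.Nullary.Decidable using (⌊_⌋)
open import Data.Fin using (_≟_)

record Graph (n : ℕ) : Set where
  field
    m        : ℕ
    ends     : Fin m → Fin n × Fin n
    loopless : ∀ e → proj₁ (ends e) ≢ proj₂ (ends e)
open Graph public

sumFin : (k : ℕ) → (Fin k → ℕ) → ℕ
sumFin zero    f = 0
sumFin (suc k) f = f zero + sumFin k (λ i → f (suc i))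

countFin : (k : ℕ) → (Fin k → Bool) → ℕ
countFin k p = sumFin k (λ i → if p i then 1 else 0)

SetFn : ℕ → Set
SetFn n = Subset n → ℕ

ℓv : ∀ {n} → SetFn n → Fin n → ℕ
ℓv ℓ v = ℓ ⁅ v ⁆

sumℓ : ∀ {n} → SetFn n → Subset n → ℕ
sumℓ {n} ℓ A = sumFin n (λ v → if ⌊ v ∈? A ⌋ then ℓv ℓ v else 0)

WeaklySubadditive : ∀ {n} → SetFn n → Set
WeaklySubadditive {n} ℓ = ∀ (A : Subset n) → ℓ A ≤ sumℓ ℓ A

eG : ∀ {n} → Graph n → Subset n → ℕ
eG G X = countFin (m G) (λ e →
  ⌊ proj₁ (ends G e) ∈? X ⌋ ∧ ⌊ proj₂ (ends G e) ∈? X ⌋)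

-- Minimally ℓ-rigid (truncated subtraction is harmless: for weakly
-- subadditive ℓ the subtracted quantity never exceeds the sum).
MinimallyRigid : ∀ {n} → Graph n → SetFn n → Set
MinimallyRigid {n} G ℓ =
  (∀ (X : Subset n) → eG G X ≤ sumℓ ℓ X ∸ ℓ X)
  × (m G ≡ sumℓ ℓ ⊤ ∸ ℓ ⊤)

-- An orientation chooses, for each edge e with ends (u , v), a direction:
-- true means the arc u → v, false means the arc v → u.
Orientation : ∀ {n} → Graph n → Set
Orientation G = Fin (m G) → Bool

tailO : ∀ {n} (G : Graph n) → Orientation G → Fin (m G) → Fin n
tailO G o e = if o e then proj₁ (ends G e) else proj₂ (ends G e)

headO : ∀ {n} (G : Graph n) → Orientation G → Fin (m G) → Fin n
headO G o e = if o e then proj₂ (ends G e) else proj₁ (ends G e)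

inDegSet : ∀ {n} (G : Graph n) → Orientation G → Subset n → ℕ
inDegSet G o A = countFin (m G) (λ e →
  not ⌊ tailO G o e ∈? A ⌋ ∧ ⌊ headO G o e ∈? A ⌋)

inDeg : ∀ {n} (G : Graph n) → Orientation G → Fin n → ℕ
inDeg G o v = countFin (m G) (λ e → ⌊ headO G o e ≟ v ⌋)

ArcConnected : ∀ {n} (G : Graph n) → Orientation G → SetFn n → Set
ArcConnected {n} G o ℓ = ∀ (A : Subset n) → ℓ A ≤ inDegSet G o A

-- For every orientation and every vertex set A, counting the arcs with head in A gives
-- Σ_{v ∈ A} d⁻(v) = e(A) + d⁻(A). So for an orientation with d⁻(v) = ℓ(v), ℓ-arc-connectivity
-- (d⁻(A) ≥ ℓ(A)) is the same as the rigidity count e(A) ≤ Σ_{v ∈ A} ℓ(v) − ℓ(A), and A = V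
-- gives |E| = Σ_v ℓ(v). It remains to find an orientation with in-degrees ℓ(v) in a minimally
-- ℓ-rigid graph; this is Hakimi's theorem: a graph with e(X) ≤ c(X) for all X and |E| = c(V)
-- has an orientation with in-degrees c. Orient the edges one by one: the edge uv may enter v
-- unless some X containing v is tight after its removal, and may enter u unless some such Y
-- containing u exists; both cannot happen, because e is supermodular and c is modular, which
-- would make X ∪ Y violate the hypothesis.
module Submission where

open import Defs
open import Data.Nat using (ℕ; _≤_)
open import Data.Fin using (Fin)
open import Data.Fin.Subset using (⊥; ⊤)
open import Data.Product using (Σ; _×_)
open import Function.Bundles using (_⇔_)
open import Relation.Binary.PropositionalEquality using (_≡_)

import Algebra.Properties.CommutativeMonoid.Sum as CommutativeMonoidSum
open import Data.Bool using (Bool; true; false; if_then_else_; _∧_; _∨_; not; T)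
open import Data.Bool.Properties using (∧-comm)
open import Data.Fin using (zero; suc; _≟_)
open import Data.Fin.Subset using (Subset; ⁅_⁆; _∪_; _∩_)
open import Data.Fin.Subset.Properties
  using (_∈?_; ∈⊤; x∈⁅x⁆; x∈⁅y⁆⇒x≡y; x∈p∪q⁺; x∈p∪q⁻; x∈p∩q⁺; x∈p∩q⁻; anySubset?)
open import Data.Nat using (zero; suc; _+_; _∸_; _<_; _≤ᵇ_; z≤n; s≤s)
open import Data.Nat.Properties hiding (_≟_)
open import Data.Nat.Solver using (module +-*-Solver)
open import Data.Product using (_,_; proj₁; proj₂; ∃)
open import Data.Sum using (inj₁; inj₂; [_,_]′)
open import Function using (_∘_)
open import Function.Bundles using (mk⇔)
open import Relation.Binary.PropositionalEquality
  using (refl; sym; trans; cong; cong₂; subst; module ≡-Reasoning)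
open import Relation.Nullary using (¬_; Dec; yes; no)
open import Relation.Nullary.Decidable
  using (⌊_⌋; isYes≗does; dec-true; dec-false; ⌊⌋-map′; decidable-stable; ¬?)

open +-*-Solver using (solve; _:=_; _:+_; con)
module ∑ = CommutativeMonoidSum +-0-commutativeMonoid

𝟙 : Bool → ℕ
𝟙 b = if b then 1 else 0

≤-closed : ∀ {m n} {_ : T (m ≤ᵇ n)} → m ≤ n
≤-closed {m} {n} {m≤ᵇn} = ≤ᵇ⇒≤ m n m≤ᵇn

𝟙-split : ∀ a b → 𝟙 b ≡ 𝟙 (a ∧ b) + 𝟙 (not a ∧ b)
𝟙-split true  true  = refl
𝟙-split true  false = refl
𝟙-split false true  = refl
𝟙-split false false = refl

if-𝟙-comm : ∀ a b → (if a then 𝟙 b else 0) ≡ (if b then 𝟙 a else 0)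
if-𝟙-comm true  true  = refl
if-𝟙-comm true  false = refl
if-𝟙-comm false true  = refl
if-𝟙-comm false false = refl

if-+ : ∀ b x y → (if b then x + y else 0) ≡ (if b then x else 0) + (if b then y else 0)
if-+ true  x y = refl
if-+ false x y = refl

if-∨-∧ : ∀ a b x →
  (if a then x else 0) + (if b then x else 0) ≡ (if a ∨ b then x else 0) + (if a ∧ b then x else 0)
if-∨-∧ true  true  x = refl
if-∨-∧ true  false x = refl
if-∨-∧ false true  x = +-comm 0 x
if-∨-∧ false false x = refl

𝟙-∧-supermodular : ∀ a b a′ b′ →
  𝟙 (a ∧ b) + 𝟙 (a′ ∧ b′) ≤ 𝟙 ((a ∨ a′) ∧ (b ∨ b′)) + 𝟙 ((a ∧ a′) ∧ (b ∧ b′))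
𝟙-∧-supermodular true  true  true  true  = ≤-closed
𝟙-∧-supermodular true  true  true  false = ≤-closed
𝟙-∧-supermodular true  true  false true  = ≤-closed
𝟙-∧-supermodular true  true  false false = ≤-closed
𝟙-∧-supermodular true  false true  true  = ≤-closed
𝟙-∧-supermodular true  false true  false = ≤-closed
𝟙-∧-supermodular true  false false true  = ≤-closed
𝟙-∧-supermodular true  false false false = ≤-closed
𝟙-∧-supermodular false true  true  true  = ≤-closed
𝟙-∧-supermodular false true  true  false = ≤-closed
𝟙-∧-supermodular false true  false true  = ≤-closed
𝟙-∧-supermodular false true  false false = ≤-closed
𝟙-∧-supermodular false false true  true  = ≤-closed
𝟙-∧-supermodular false false true  false = ≤-closed
𝟙-∧-supermodular false false false true  = ≤-closed
𝟙-∧-supermodular false false false false = ≤-closed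

𝟙-≤-1+𝟙-∨-∧ : ∀ a b c d → 𝟙 b + 𝟙 c ≤ 1 + 𝟙 ((a ∨ c) ∧ (b ∨ d))
𝟙-≤-1+𝟙-∨-∧ a     false false d = z≤n
𝟙-≤-1+𝟙-∨-∧ a     true  false d = s≤s z≤n
𝟙-≤-1+𝟙-∨-∧ a     false true  d = s≤s z≤n
𝟙-≤-1+𝟙-∨-∧ true  true  true  d = ≤-refl
𝟙-≤-1+𝟙-∨-∧ false true  true  d = ≤-refl

⌊⌋-true : ∀ {a} {A : Set a} (a? : Dec A) → A → ⌊ a? ⌋ ≡ true
⌊⌋-true a? a = trans (isYes≗does a?) (dec-true a? a)

⌊⌋-false : ∀ {a} {A : Set a} (a? : Dec A) → ¬ A → ⌊ a? ⌋ ≡ false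
⌊⌋-false a? ¬a = trans (isYes≗does a?) (dec-false a? ¬a)

infix 8 _∈ᵇ_
_∈ᵇ_ : ∀ {n} → Fin n → Subset n → Bool
v ∈ᵇ X = ⌊ v ∈? X ⌋

∈ᵇ-⊤ : ∀ {n} (v : Fin n) → v ∈ᵇ ⊤ ≡ true
∈ᵇ-⊤ v = ⌊⌋-true (v ∈? ⊤) ∈⊤

∈ᵇ-⁅⁆ : ∀ {n} (w v : Fin n) → v ∈ᵇ ⁅ w ⁆ ≡ ⌊ w ≟ v ⌋
∈ᵇ-⁅⁆ w v with w ≟ v
... | yes refl = ⌊⌋-true (v ∈? ⁅ w ⁆) (x∈⁅x⁆ w)
... | no  w≢v  = ⌊⌋-false (v ∈? ⁅ w ⁆) (w≢v ∘ sym ∘ x∈⁅y⁆⇒x≡y w)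

∈ᵇ-∪ : ∀ {n} (v : Fin n) X Y → v ∈ᵇ (X ∪ Y) ≡ (v ∈ᵇ X ∨ v ∈ᵇ Y)
∈ᵇ-∪ v X Y with v ∈? X | v ∈? Y
... | yes v∈X | _       = ⌊⌋-true (v ∈? X ∪ Y) (x∈p∪q⁺ (inj₁ v∈X))
... | no  _   | yes v∈Y = ⌊⌋-true (v ∈? X ∪ Y) (x∈p∪q⁺ (inj₂ v∈Y))
... | no  v∉X | no  v∉Y = ⌊⌋-false (v ∈? X ∪ Y) ([ v∉X , v∉Y ]′ ∘ x∈p∪q⁻ X Y)

∈ᵇ-∩ : ∀ {n} (v : Fin n) X Y → v ∈ᵇ (X ∩ Y) ≡ (v ∈ᵇ X ∧ v ∈ᵇ Y)
∈ᵇ-∩ v X Y with v ∈? X | v ∈? Y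
... | yes v∈X | yes v∈Y = ⌊⌋-true (v ∈? X ∩ Y) (x∈p∩q⁺ (v∈X , v∈Y))
... | yes _   | no  v∉Y = ⌊⌋-false (v ∈? X ∩ Y) (v∉Y ∘ proj₂ ∘ x∈p∩q⁻ X Y)
... | no  v∉X | _       = ⌊⌋-false (v ∈? X ∩ Y) (v∉X ∘ proj₁ ∘ x∈p∩q⁻ X Y)

sumFin-cong : ∀ k {f g : Fin k → ℕ} → (∀ i → f i ≡ g i) → sumFin k f ≡ sumFin k g
sumFin-cong zero    f≗g = refl
sumFin-cong (suc k) f≗g = cong₂ _+_ (f≗g zero) (sumFin-cong k (f≗g ∘ suc))

sumFin-mono-≤ : ∀ k {f g : Fin k → ℕ} → (∀ i → f i ≤ g i) → sumFin k f ≤ sumFin k g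
sumFin-mono-≤ zero    f≤g = z≤n
sumFin-mono-≤ (suc k) f≤g = +-mono-≤ (f≤g zero) (sumFin-mono-≤ k (f≤g ∘ suc))

sumFin-0 : ∀ k → sumFin k (λ _ → 0) ≡ 0
sumFin-0 zero    = refl
sumFin-0 (suc k) = sumFin-0 k

sumFin-1 : ∀ k → sumFin k (λ _ → 1) ≡ k
sumFin-1 zero    = refl
sumFin-1 (suc k) = cong suc (sumFin-1 k)

sumFin≡sum : ∀ k (f : Fin k → ℕ) → sumFin k f ≡ ∑.sum f
sumFin≡sum zero    f = refl
sumFin≡sum (suc k) f = cong (f zero +_) (sumFin≡sum k (f ∘ suc))

sumFin-distrib-+ : ∀ k (f g : Fin k → ℕ) → sumFin k (λ i → f i + g i) ≡ sumFin k f + sumFin k g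
sumFin-distrib-+ k f g = begin
  sumFin k (λ i → f i + g i)  ≡⟨ sumFin≡sum k _ ⟩
  ∑.sum (λ i → f i + g i)     ≡⟨ ∑.∑-distrib-+ f g ⟩
  ∑.sum f + ∑.sum g           ≡⟨ cong₂ _+_ (sumFin≡sum k f) (sumFin≡sum k g) ⟨
  sumFin k f + sumFin k g     ∎
  where open ≡-Reasoning

sumFin-comm : ∀ j k (f : Fin j → Fin k → ℕ) →
  sumFin j (λ i → sumFin k (f i)) ≡ sumFin k (λ i′ → sumFin j (λ i → f i i′))
sumFin-comm j k f = begin
  sumFin j (λ i → sumFin k (f i))          ≡⟨ trans (sumFin≡sum j _) (∑.sum-cong-≗ (sumFin≡sum k ∘ f)) ⟩
  ∑.sum (λ i → ∑.sum (f i))                ≡⟨ ∑.∑-comm f ⟩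
  ∑.sum (λ i′ → ∑.sum (λ i → f i i′))      ≡⟨ trans (sumFin≡sum k _) (∑.sum-cong-≗ (λ i′ → sumFin≡sum j (λ i → f i i′))) ⟨
  sumFin k (λ i′ → sumFin j (λ i → f i i′)) ∎
  where open ≡-Reasoning

sumFin≡0⇒≡0 : ∀ k (f : Fin k → ℕ) → sumFin k f ≡ 0 → ∀ i → f i ≡ 0
sumFin≡0⇒≡0 (suc k) f ∑f≡0 zero    = m+n≡0⇒m≡0 (f zero) ∑f≡0
sumFin≡0⇒≡0 (suc k) f ∑f≡0 (suc i) = sumFin≡0⇒≡0 k (f ∘ suc) (m+n≡0⇒n≡0 (f zero) ∑f≡0) i

sumFin-δ : ∀ {n} (w : Fin n) (f : Fin n → ℕ) → sumFin n (λ v → if ⌊ w ≟ v ⌋ then f v else 0) ≡ f w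
sumFin-δ {suc n} zero    f = trans (cong (f zero +_) (sumFin-0 n)) (+-identityʳ (f zero))
sumFin-δ {suc n} (suc w) f = trans
  (sumFin-cong n (λ v → cong (λ b → if b then f (suc v) else 0) (⌊⌋-map′ _ _ (w ≟ v))))
  (sumFin-δ w (f ∘ suc))

-- sumℓ ℓ is definitionally weight (ℓv ℓ).
weight : ∀ {n} → (Fin n → ℕ) → Subset n → ℕ
weight {n} c X = sumFin n (λ v → if v ∈ᵇ X then c v else 0)

module _ {n : ℕ} where

  weight-cong : ∀ {c c′ : Fin n → ℕ} → (∀ v → c v ≡ c′ v) → ∀ X → weight c X ≡ weight c′ X
  weight-cong c≗c′ X = sumFin-cong n (λ v → cong (λ x → if v ∈ᵇ X then x else 0) (c≗c′ v))

  weight-distrib-+ : ∀ (c c′ : Fin n → ℕ) X → weight (λ v → c v + c′ v) X ≡ weight c X + weight c′ X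
  weight-distrib-+ c c′ X = trans (sumFin-cong n (λ v → if-+ (v ∈ᵇ X) (c v) (c′ v))) (sumFin-distrib-+ n _ _)

  weight-⊤ : ∀ (c : Fin n → ℕ) → weight c ⊤ ≡ sumFin n c
  weight-⊤ c = sumFin-cong n (λ v → cong (λ b → if b then c v else 0) (∈ᵇ-⊤ v))

  weight-⁅⁆ : ∀ (c : Fin n → ℕ) w → weight c ⁅ w ⁆ ≡ c w
  weight-⁅⁆ c w = trans (sumFin-cong n (λ v → cong (λ b → if b then c v else 0) (∈ᵇ-⁅⁆ w v))) (sumFin-δ w c)

  weight-δ : ∀ (w : Fin n) X → weight (λ v → 𝟙 ⌊ w ≟ v ⌋) X ≡ 𝟙 (w ∈ᵇ X)
  weight-δ w X = trans (sumFin-cong n (λ v → if-𝟙-comm (v ∈ᵇ X) ⌊ w ≟ v ⌋)) (sumFin-δ w (λ v → 𝟙 (v ∈ᵇ X)))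

  weight-sumFin-comm : ∀ k (g : Fin k → Fin n → ℕ) X →
    weight (λ v → sumFin k (λ i → g i v)) X ≡ sumFin k (λ i → weight (g i) X)
  weight-sumFin-comm k g X = trans (sumFin-cong n (λ v → if-sumFin (v ∈ᵇ X) (λ i → g i v)))
                                   (sumFin-comm n k _)
    where
    if-sumFin : ∀ b (h : Fin k → ℕ) → (if b then sumFin k h else 0) ≡ sumFin k (λ i → if b then h i else 0)
    if-sumFin true  h = refl
    if-sumFin false h = sym (sumFin-0 k)

  weight-modular : ∀ (c : Fin n → ℕ) X Y → weight c X + weight c Y ≡ weight c (X ∪ Y) + weight c (X ∩ Y)
  weight-modular c X Y = begin
    weight c X + weight c Y                                                   ≡⟨ sumFin-distrib-+ n _ _ ⟨
    sumFin n (λ v → (if v ∈ᵇ X then c v else 0) + (if v ∈ᵇ Y then c v else 0)) ≡⟨ sumFin-cong n ∪∩ ⟩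
    sumFin n (λ v → (if v ∈ᵇ (X ∪ Y) then c v else 0) + (if v ∈ᵇ (X ∩ Y) then c v else 0))
                                                                              ≡⟨ sumFin-distrib-+ n _ _ ⟩
    weight c (X ∪ Y) + weight c (X ∩ Y)                                       ∎
    where
    open ≡-Reasoning
    ∪∩ : ∀ v → (if v ∈ᵇ X then c v else 0) + (if v ∈ᵇ Y then c v else 0)
             ≡ (if v ∈ᵇ (X ∪ Y) then c v else 0) + (if v ∈ᵇ (X ∩ Y) then c v else 0)
    ∪∩ v rewrite ∈ᵇ-∪ v X Y | ∈ᵇ-∩ v X Y = if-∨-∧ (v ∈ᵇ X) (v ∈ᵇ Y) (c v)

  decrementAt : Fin n → (Fin n → ℕ) → Fin n → ℕ
  decrementAt w c v = c v ∸ 𝟙 ⌊ w ≟ v ⌋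

  δ+decrementAt : ∀ (c : Fin n → ℕ) w → 1 ≤ c w → ∀ v → 𝟙 ⌊ w ≟ v ⌋ + decrementAt w c v ≡ c v
  δ+decrementAt c w 1≤cw v with w ≟ v
  ... | yes refl = m+[n∸m]≡n 1≤cw
  ... | no  _    = refl

  weight-decrementAt : ∀ (c : Fin n → ℕ) w → 1 ≤ c w → ∀ X →
    weight c X ≡ 𝟙 (w ∈ᵇ X) + weight (decrementAt w c) X
  weight-decrementAt c w 1≤cw X = begin
    weight c X                                                 ≡⟨ weight-cong (δ+decrementAt c w 1≤cw) X ⟨
    weight (λ v → 𝟙 ⌊ w ≟ v ⌋ + decrementAt w c v) X           ≡⟨ weight-distrib-+ _ _ X ⟩
    weight (λ v → 𝟙 ⌊ w ≟ v ⌋) X + weight (decrementAt w c) X  ≡⟨ cong (_+ weight (decrementAt w c) X) (weight-δ w X) ⟩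
    𝟙 (w ∈ᵇ X) + weight (decrementAt w c) X                    ∎
    where open ≡-Reasoning

module _ {n : ℕ} where

  bothEndsIn : (G : Graph n) → Subset n → Fin (m G) → Bool
  bothEndsIn G X e = proj₁ (ends G e) ∈ᵇ X ∧ proj₂ (ends G e) ∈ᵇ X

  eG-⊤ : ∀ (G : Graph n) → eG G ⊤ ≡ m G
  eG-⊤ G = trans (sumFin-cong (m G) (λ e → cong₂ (λ a b → 𝟙 (a ∧ b)) (∈ᵇ-⊤ (proj₁ (ends G e))) (∈ᵇ-⊤ (proj₂ (ends G e))))) (sumFin-1 (m G))

  inDegSet-⊤ : ∀ (G : Graph n) o → inDegSet G o ⊤ ≡ 0
  inDegSet-⊤ G o = trans (sumFin-cong (m G) (λ e → cong (λ a → 𝟙 (not a ∧ headO G o e ∈ᵇ ⊤)) (∈ᵇ-⊤ (tailO G o e))))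
                         (sumFin-0 (m G))

  eG-supermodular : ∀ (G : Graph n) X Y → eG G X + eG G Y ≤ eG G (X ∪ Y) + eG G (X ∩ Y)
  eG-supermodular G X Y = begin
    eG G X + eG G Y                                         ≡⟨ sumFin-distrib-+ (m G) _ _ ⟨
    sumFin (m G) (λ e → 𝟙 (bothEndsIn G X e) + 𝟙 (bothEndsIn G Y e))
                                                            ≤⟨ sumFin-mono-≤ (m G) ∪∩ ⟩
    sumFin (m G) (λ e → 𝟙 (bothEndsIn G (X ∪ Y) e) + 𝟙 (bothEndsIn G (X ∩ Y) e))
                                                            ≡⟨ sumFin-distrib-+ (m G) _ _ ⟩
    eG G (X ∪ Y) + eG G (X ∩ Y)                             ∎
    where
    open ≤-Reasoning
    ∪∩ : ∀ e → 𝟙 (bothEndsIn G X e) + 𝟙 (bothEndsIn G Y e)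
             ≤ 𝟙 (bothEndsIn G (X ∪ Y) e) + 𝟙 (bothEndsIn G (X ∩ Y) e)
    ∪∩ e with ends G e
    ... | p , q rewrite ∈ᵇ-∪ p X Y | ∈ᵇ-∪ q X Y | ∈ᵇ-∩ p X Y | ∈ᵇ-∩ q X Y =
      𝟙-∧-supermodular (p ∈ᵇ X) (q ∈ᵇ X) (p ∈ᵇ Y) (q ∈ᵇ Y)

  tail∧head-∈ᵇ : ∀ (G : Graph n) o e X → (tailO G o e ∈ᵇ X ∧ headO G o e ∈ᵇ X) ≡ bothEndsIn G X e
  tail∧head-∈ᵇ G o e X with o e
  ... | true  = refl
  ... | false = ∧-comm (proj₂ (ends G e) ∈ᵇ X) (proj₁ (ends G e) ∈ᵇ X)

  weight-inDeg : ∀ (G : Graph n) o A → weight (inDeg G o) A ≡ eG G A + inDegSet G o A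
  weight-inDeg G o A = begin
    weight (inDeg G o) A                                         ≡⟨ weight-sumFin-comm (m G) _ A ⟩
    sumFin (m G) (λ e → weight (λ v → 𝟙 ⌊ headO G o e ≟ v ⌋) A)  ≡⟨ sumFin-cong (m G) (λ e → weight-δ _ A) ⟩
    sumFin (m G) (λ e → 𝟙 (headO G o e ∈ᵇ A))                    ≡⟨ sumFin-cong (m G) head-split ⟩
    sumFin (m G) (λ e → 𝟙 (bothEndsIn G A e) + 𝟙 (entering e))   ≡⟨ sumFin-distrib-+ (m G) _ _ ⟩
    eG G A + inDegSet G o A                                      ∎
    where
    open ≡-Reasoning
    entering : Fin (m G) → Bool
    entering e = not (tailO G o e ∈ᵇ A) ∧ headO G o e ∈ᵇ A
    head-split : ∀ e → 𝟙 (headO G o e ∈ᵇ A) ≡ 𝟙 (bothEndsIn G A e) + 𝟙 (entering e)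
    head-split e = trans (𝟙-split (tailO G o e ∈ᵇ A) (headO G o e ∈ᵇ A))
                         (cong (λ b → 𝟙 b + 𝟙 (entering e)) (tail∧head-∈ᵇ G o e A))

-- Hakimi's orientation theorem

module _ {n : ℕ} where

  Sparse : Graph n → (Fin n → ℕ) → Set
  Sparse G c = ∀ X → eG G X ≤ weight c X

  HasOrientationWithInDeg : Graph n → (Fin n → ℕ) → Set
  HasOrientationWithInDeg G c = Σ (Orientation G) (λ o → ∀ v → inDeg G o v ≡ c v)

  -- If X cannot take the extra edge uv entering v, every Y can take it entering u: otherwise
  -- supermodularity of eG and modularity of weight make X ∪ Y violate sparsity of H + uv.
  uncross : ∀ (H : Graph n) (c : Fin n → ℕ) (u v : Fin n) →
    (∀ Z → 𝟙 (u ∈ᵇ Z ∧ v ∈ᵇ Z) + eG H Z ≤ weight c Z) →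
    ∀ {X} → weight c X < 𝟙 (v ∈ᵇ X) + eG H X → ∀ Y → 𝟙 (u ∈ᵇ Y) + eG H Y ≤ weight c Y
  uncross H c u v sparse {X} X-overfull Y = +-cancelʳ-≤ (suc (C X)) _ _ (begin
    (𝟙 (u ∈ᵇ Y) + e Y) + suc (C X)              ≤⟨ +-monoʳ-≤ _ X-overfull ⟩
    (𝟙 (u ∈ᵇ Y) + e Y) + (𝟙 (v ∈ᵇ X) + e X)     ≡⟨ swap-middle (𝟙 (u ∈ᵇ Y)) (e Y) (𝟙 (v ∈ᵇ X)) (e X) ⟩
    (e X + e Y) + (𝟙 (v ∈ᵇ X) + 𝟙 (u ∈ᵇ Y))     ≤⟨ +-mono-≤ (eG-supermodular H X Y) covered ⟩
    (e (X ∪ Y) + e (X ∩ Y)) + (1 + t)           ≡⟨ regroup (e (X ∪ Y)) (e (X ∩ Y)) t ⟩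
    suc ((t + e (X ∪ Y)) + e (X ∩ Y))           ≤⟨ s≤s (+-mono-≤ (sparse (X ∪ Y)) (m+n≤o⇒n≤o _ (sparse (X ∩ Y)))) ⟩
    suc (C (X ∪ Y) + C (X ∩ Y))                 ≡⟨ cong suc (weight-modular _ X Y) ⟨
    suc (C X + C Y)                             ≡⟨ trans (cong suc (+-comm (C X) (C Y))) (sym (+-suc (C Y) (C X))) ⟩
    C Y + suc (C X)                             ∎)
    where
    open ≤-Reasoning
    e : Subset n → ℕ
    e = eG H
    C : Subset n → ℕ
    C = weight c
    t : ℕ
    t = 𝟙 (u ∈ᵇ (X ∪ Y) ∧ v ∈ᵇ (X ∪ Y))
    covered : 𝟙 (v ∈ᵇ X) + 𝟙 (u ∈ᵇ Y) ≤ 1 + t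
    covered rewrite ∈ᵇ-∪ u X Y | ∈ᵇ-∪ v X Y = 𝟙-≤-1+𝟙-∨-∧ (u ∈ᵇ X) (v ∈ᵇ X) (u ∈ᵇ Y) (v ∈ᵇ Y)
    swap-middle : ∀ a b p q → (a + b) + (p + q) ≡ (q + b) + (p + a)
    swap-middle = solve 4 (λ a b p q → (a :+ b) :+ (p :+ q) := (q :+ b) :+ (p :+ a)) refl
    regroup : ∀ a b x → (a + b) + (1 + x) ≡ suc ((x + a) + b)
    regroup = solve 3 (λ a b x → (a :+ b) :+ (con 1 :+ x) := con 1 :+ ((x :+ a) :+ b)) refl

  -- The edge count k is an explicit index so that deleting the first edge is structural recursion.
  hakimi : ∀ k (G : Graph n) → m G ≡ k → ∀ c → Sparse G c → k ≡ weight c ⊤ → HasOrientationWithInDeg G c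
  hakimi zero    _ refl c _ size = (λ ()) , λ v → sym (sumFin≡0⇒≡0 n c (trans (sym (weight-⊤ c)) (sym size)) v)
  hakimi (suc k) G@record { ends = ends ; loopless = loopless } refl c sparse size =
    orient (anySubset? (λ X → ¬? (fits? true X)))
    where
    G′ : Graph n
    G′ = record { m = k ; ends = ends ∘ suc ; loopless = loopless ∘ suc }

    head : Bool → Fin n
    head b = if b then proj₂ (ends zero) else proj₁ (ends zero)

    Fits : Bool → Subset n → Set
    Fits b X = 𝟙 (head b ∈ᵇ X) + eG G′ X ≤ weight c X

    fits? : ∀ b X → Dec (Fits b X)
    fits? b X = _ ≤? _

    orient-first-edge : ∀ b → (∀ X → Fits b X) → HasOrientationWithInDeg G c
    orient-first-edge b fits = o , inDeg≡
      where
      w = head b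
      1≤cw : 1 ≤ c w
      1≤cw = begin
        1                             ≡⟨ cong 𝟙 (⌊⌋-true (w ∈? ⁅ w ⁆) (x∈⁅x⁆ w)) ⟨
        𝟙 (w ∈ᵇ ⁅ w ⁆)                ≤⟨ m≤m+n _ _ ⟩
        𝟙 (w ∈ᵇ ⁅ w ⁆) + eG G′ ⁅ w ⁆  ≤⟨ fits ⁅ w ⁆ ⟩
        weight c ⁅ w ⁆                ≡⟨ weight-⁅⁆ c w ⟩
        c w                           ∎
        where open ≤-Reasoning
      rest : HasOrientationWithInDeg G′ (decrementAt w c)
      rest = hakimi k G′ refl (decrementAt w c)
        (λ X → +-cancelˡ-≤ (𝟙 (w ∈ᵇ X)) (eG G′ X) _ (subst (𝟙 (w ∈ᵇ X) + eG G′ X ≤_) (weight-decrementAt c w 1≤cw X) (fits X)))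
        (suc-injective (trans size (trans (weight-decrementAt c w 1≤cw ⊤) (cong (λ b → 𝟙 b + weight (decrementAt w c) ⊤) (∈ᵇ-⊤ w)))))
      o : Orientation G
      o zero    = b
      o (suc e) = proj₁ rest e
      inDeg≡ : ∀ v → inDeg G o v ≡ c v
      inDeg≡ v = trans (cong (𝟙 ⌊ w ≟ v ⌋ +_) (proj₂ rest v)) (δ+decrementAt c w 1≤cw v)

    orient : Dec (∃ λ X → ¬ Fits true X) → HasOrientationWithInDeg G c
    orient (yes (X , X-overfull)) =
      orient-first-edge false (uncross G′ c (head false) (head true) sparse (≰⇒> X-overfull))
    orient (no  none) =
      orient-first-edge true (λ X → decidable-stable (fits? true X) (λ ¬fits → none (X , ¬fits)))

module _ {n : ℕ} (G : Graph n) (ℓ : SetFn n) where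

  private
    OrientationWith : Set
    OrientationWith = Σ (Orientation G) (λ o → ArcConnected G o ℓ × (∀ v → inDeg G o v ≡ ℓv ℓ v))

  sumℓ≡eG+inDegSet : ∀ o → (∀ v → inDeg G o v ≡ ℓv ℓ v) → ∀ A → sumℓ ℓ A ≡ eG G A + inDegSet G o A
  sumℓ≡eG+inDegSet o inDeg≡ A = trans (weight-cong (sym ∘ inDeg≡) A) (weight-inDeg G o A)

  rigid⇒orientation : WeaklySubadditive ℓ → ℓ ⊤ ≡ 0 → MinimallyRigid G ℓ → OrientationWith
  rigid⇒orientation subadditive ℓ⊤≡0 (sparse , size) = o , arcConnected , inDeg≡
    where
    realised : HasOrientationWithInDeg G (ℓv ℓ)
    realised = hakimi (m G) G refl (ℓv ℓ) (λ X → ≤-trans (sparse X) (m∸n≤m (sumℓ ℓ X) (ℓ X)))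
                      (trans size (cong (sumℓ ℓ ⊤ ∸_) ℓ⊤≡0))
    o = proj₁ realised
    inDeg≡ = proj₂ realised
    arcConnected : ArcConnected G o ℓ
    arcConnected A = +-cancelˡ-≤ (eG G A) _ _ (begin
      eG G A + ℓ A               ≤⟨ +-monoˡ-≤ (ℓ A) (sparse A) ⟩
      (sumℓ ℓ A ∸ ℓ A) + ℓ A     ≡⟨ m∸n+n≡m (subadditive A) ⟩
      sumℓ ℓ A                   ≡⟨ sumℓ≡eG+inDegSet o inDeg≡ A ⟩
      eG G A + inDegSet G o A    ∎)
      where open ≤-Reasoning

  orientation⇒rigid : ℓ ⊤ ≡ 0 → OrientationWith → MinimallyRigid G ℓ
  orientation⇒rigid ℓ⊤≡0 (o , arcConnected , inDeg≡) = sparse , size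
    where
    sparse : ∀ X → eG G X ≤ sumℓ ℓ X ∸ ℓ X
    sparse X = begin
      eG G X                                      ≡⟨ m+n∸n≡m (eG G X) (inDegSet G o X) ⟨
      eG G X + inDegSet G o X ∸ inDegSet G o X    ≡⟨ cong (_∸ inDegSet G o X) (sumℓ≡eG+inDegSet o inDeg≡ X) ⟨
      sumℓ ℓ X ∸ inDegSet G o X                   ≤⟨ ∸-monoʳ-≤ _ (arcConnected X) ⟩
      sumℓ ℓ X ∸ ℓ X                              ∎
      where open ≤-Reasoning
    size : m G ≡ sumℓ ℓ ⊤ ∸ ℓ ⊤
    size = begin
      m G                            ≡⟨ eG-⊤ G ⟨
      eG G ⊤                         ≡⟨ +-identityʳ _ ⟨
      eG G ⊤ + 0                     ≡⟨ cong (eG G ⊤ +_) (inDegSet-⊤ G o) ⟨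
      eG G ⊤ + inDegSet G o ⊤        ≡⟨ sumℓ≡eG+inDegSet o inDeg≡ ⊤ ⟨
      sumℓ ℓ ⊤                       ≡⟨ cong (sumℓ ℓ ⊤ ∸_) ℓ⊤≡0 ⟨
      sumℓ ℓ ⊤ ∸ ℓ ⊤                 ∎
      where open ≡-Reasoning

theorem7p2 : ∀ {n : ℕ} (G : Graph n) (ℓ : SetFn n) →
    WeaklySubadditive ℓ → ℓ ⊥ ≡ 0 → ℓ ⊤ ≡ 0 →
    MinimallyRigid G ℓ ⇔
      Σ (Orientation G) (λ o →
        ArcConnected G o ℓ × (∀ (v : Fin n) → inDeg G o v ≡ ℓv ℓ v))
theorem7p2 G ℓ subadditive _ ℓ⊤≡0 =
  mk⇔ (rigid⇒orientation G ℓ subadditive ℓ⊤≡0) (orientation⇒rigid G ℓ ℓ⊤≡0)
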